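{- Let $d$ be even and let $P=\{p_1,\dots,p_d\}$, $Q=\{q_1,\dots,q_d\}$ be disjoint posets with $P\cong Q\cong \mathbf I_2\oplus\cdots\oplus\mathbf I_2$ ($d/2$ summands), such that for each $1\le i\le d/2$ the induced subposets $\{p_{2i-1},p_{2i}\}$ and $\{q_{2i-1},q_{2i}\}$ are isomorphic to $\mathbf I_2$. Then $N(\Gamma(P,Q))=6^{d/2}$.
   Context: For a finite poset $P=\{p_1,\dots,p_d\}$, an antichain is a set of pairwise incomparable elements (including $\emptyset$); for an antichain $A$ put $\rho(A)=\sum_{p_i\in A}\mathbf e_i\in\mathbb R^d$. The chain polytope is $\mathcal C(P)=\mathrm{conv}\{\rho(A): A\text{ antichain}\}$. For $Q=\{q_1,\dots,q_d\}$, $\Gamma(P,Q)=\mathrm{conv}(\mathcal C(P)\cup(-\mathcal C(Q)))\subset\mathbb R^d$ (coordinate $i$ corresponds to $p_i$ and $q_i$). $N(\mathcal P)$ is the number of facets. $\mathbf I_2$ is the 2-element antichain. The ordinal sum $P\oplus Q$ of posets on disjoint sets is the poset on $P\cup Q$ with $s\le t$ iff ($s,t\in P$, $s\le_P t$) or ($s,t\in Q$, $s\le_Q t$) or ($s\in P$, $t\in Q$). -}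

module Defs where

open import Level using (0ℓ)
open import Data.Nat using (ℕ; zero; suc)
open import Data.Fin using (Fin; combine)
import Data.Fin as F
open import Data.Bool using (if_then_else_)
open import Data.Empty using (⊥)
open import Data.Sum using (_⊎_; inj₁; inj₂)
open import Data.Product using (Σ; ∃; _×_; _,_)
open import Data.Vec using (lookup)
open import Data.Fin.Subset using (Subset; _∈_)
open import Data.Rational using (ℚ; 0ℚ; 1ℚ; _+_; _*_; -_; _-_; _≤_; _<_)
import Data.Rational as Q
open import Relation.Binary.PropositionalEquality using (_≡_; _≢_)
open import Relation.Binary.Core using (Rel)
open import Relation.Binary.Structures using (IsPartialOrder)
open import Relation.Nullary using (¬_)
open import Function.Bundles using (Inverse; _⇔_)

-- Posets on Fin d (elements p_1..p_d are indices 0..d-1)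

record FinPoset (d : ℕ) : Set₁ where
  field
    _≼_ : Rel (Fin d) 0ℓ
    isPartialOrder : IsPartialOrder _≡_ _≼_

I₂-carrier : Set
I₂-carrier = Fin 2

I₂-rel : Rel I₂-carrier 0ℓ
I₂-rel = _≡_

_⊕ʳ_ : ∀ {A B : Set} → Rel A 0ℓ → Rel B 0ℓ → Rel (A ⊎ B) 0ℓ
(R ⊕ʳ S) (inj₁ x) (inj₁ y) = R x y
(R ⊕ʳ S) (inj₂ x) (inj₂ y) = S x y
(R ⊕ʳ S) (inj₁ x) (inj₂ y) = Data.Unit.Polymorphic.⊤
  where import Data.Unit.Polymorphic
(R ⊕ʳ S) (inj₂ x) (inj₁ y) = ⊥

I₂ⁿ-carrier : ℕ → Set
I₂ⁿ-carrier zero = ⊥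
I₂ⁿ-carrier (suc k) = I₂-carrier ⊎ I₂ⁿ-carrier k

I₂ⁿ-rel : (k : ℕ) → Rel (I₂ⁿ-carrier k) 0ℓ
I₂ⁿ-rel zero ()
I₂ⁿ-rel (suc k) = I₂-rel ⊕ʳ I₂ⁿ-rel k

OrderIso : ∀ {d} → FinPoset d → (C : Set) → Rel C 0ℓ → Set
OrderIso {d} P C R =
  Σ (Inverse (Data.Fin.Properties.≡-setoid d) (Relation.Binary.PropositionalEquality.setoid C)) λ f →
    ∀ x y → (FinPoset._≼_ P x y ⇔ R (Inverse.to f x) (Inverse.to f y))
  where import Data.Fin.Properties
        import Relation.Binary.PropositionalEquality

-- the induced subposet on {x , y} is isomorphic to I₂ (x ≠ y, incomparable)
InducedI₂ : ∀ {d} → FinPoset d → Fin d → Fin d → Set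
InducedI₂ P x y = x ≢ y × ¬ (FinPoset._≼_ P x y) × ¬ (FinPoset._≼_ P y x)

IsAntichain : ∀ {d} → FinPoset d → Subset d → Set
IsAntichain P A = ∀ x y → x ∈ A → y ∈ A → FinPoset._≼_ P x y → x ≡ y

Vecℚ : ℕ → Set
Vecℚ d = Fin d → ℚ

sumFin : ∀ {n} → (Fin n → ℚ) → ℚ
sumFin {zero} f = 0ℚ
sumFin {suc n} f = f F.zero + sumFin (λ i → f (F.suc i))

_·_ : ∀ {d} → Vecℚ d → Vecℚ d → ℚ
a · x = sumFin (λ i → a i * x i)

ρ : ∀ {d} → Subset d → Vecℚ d
ρ A i = if lookup A i then 1ℚ else 0ℚ

neg : ∀ {d} → Vecℚ d → Vecℚ d
neg x i = - x i

-- A finite point set given as a predicate on ℚ^d; the polytope is its convex hull.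
PointSet : ℕ → Set₁
PointSet d = Vecℚ d → Set

-- generators of Γ(P,Q) = conv(C(P) ∪ (-C(Q))):  ρ(A) for antichains A of P,
-- and -ρ(B) for antichains B of Q
ΓGen : ∀ {d} → FinPoset d → FinPoset d → PointSet d
ΓGen P Q x = (∃ λ A → IsAntichain P A × x ≡ ρ A) ⊎ (∃ λ B → IsAntichain Q B × x ≡ neg (ρ B))

AffinelyIndependent : ∀ {d m} → (Fin m → Vecℚ d) → Set
AffinelyIndependent {d} {m} y =
  ∀ (c : Fin m → ℚ) → sumFin c ≡ 0ℚ → (∀ i → sumFin (λ j → c j * y j i) ≡ 0ℚ) → ∀ j → c j ≡ 0ℚ

-- (a , b) defines a facet of conv(G) ⊂ ℝ^d: a·x ≤ b is valid on G, not tight on all of G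
-- (proper face), and the face {a·x = b} contains d affinely independent points of G
-- (so the face has dimension d-1).
IsFacetIneq : ∀ {d} → PointSet d → Vecℚ d → ℚ → Set
IsFacetIneq {d} G a b =
  (∀ x → G x → a · x ≤ b) ×
  (∃ λ x → G x × a · x < b) ×
  (∃ λ (y : Fin d → Vecℚ d) → (∀ j → G (y j) × a · y j ≡ b) × AffinelyIndependent y)

-- two valid inequalities define the same face of conv(G) (faces determined by the generators on them)
SameFace : ∀ {d} → PointSet d → (Vecℚ d × ℚ) → (Vecℚ d × ℚ) → Set
SameFace G (a , b) (a' , b') = ∀ x → G x → (a · x ≡ b ⇔ a' · x ≡ b')

HasNumFacets : ∀ {d} → PointSet d → ℕ → Set
HasNumFacets {d} G n =
  Σ (Fin n → Vecℚ d × ℚ) λ h →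
    (∀ j → IsFacetIneq G (Data.Product.proj₁ (h j)) (Data.Product.proj₂ (h j))) ×
    (∀ i j → i ≢ j → ¬ SameFace G (h i) (h j)) ×
    (∀ a b → IsFacetIneq G a b → ∃ λ j → SameFace G (a , b) (h j))

-- Under the hypotheses every antichain of P (or Q) is empty or a nonempty subset of a single
-- block {p₂ₘ₋₁, p₂ₘ}, so the generators of Γ(P, Q) are 0 and, in the coordinate plane of each
-- block, the six vertices ±ρ(S) of the hexagon H = Γ(I₂, I₂). Thus Γ(P, Q) is the free sum of
-- d/2 copies of H, and its facets are the inequalities Σₘ ⟨n(σ m), xₘ⟩ ≤ 1, one for each choice
-- σ of an edge of H in every block, n(s) being the normal of edge s. Conversely, a facet
-- a·x ≤ b has b > 0 and d affinely independent tight generators. Two tight vertices of H in one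
-- block are adjacent, hence of different parity, so labelling the tight generators by block and
-- parity is injective, hence onto: every block carries a tight edge s, and a equals b·n(s) there.

module Submission where

open import Defs
open import Data.Nat using (ℕ; _*_; _^_)
open import Data.Fin using (Fin; combine)
import Data.Fin as F

open import Level using (0ℓ)
import Data.Nat as ℕ
open import Data.Nat.Properties using (1+n≰n)
open import Data.Nat using (zero; suc)
open import Data.Fin using (_↑ˡ_; _↑ʳ_; punchOut; finToFun; funToFin)
open import Data.Fin.Patterns using (0F; 1F; 2F; 3F; 4F; 5F)
open import Data.Fin.Properties
  using (combine-injective; combine-surjective; remQuot-combine; suc-injective; any?; all?; ¬∀⟶∃¬;
         finToFun-funToFin; funToFin-finToFin; punchOut-injective; injective⇒≤; 0≢1+n)
open import Data.Bool using (Bool; true; false; if_then_else_)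
open import Data.Empty using (⊥-elim)
open import Data.Sum using (_⊎_; inj₁; inj₂)
open import Data.Product using (∃; ∃₂; _×_; _,_; proj₁; proj₂; uncurry; swap)
open import Data.Vec using (_∷_; []; lookup; tabulate)
open import Data.Vec.Properties using (lookup∘tabulate; lookup-replicate; []=⇒lookup; lookup⇒[]=)
open import Data.Vec.Functional using (Vector; concat)
open import Data.Fin.Subset using (Subset; _∈_; inside; outside; Nonempty)
import Data.Fin.Subset as Sub
open import Data.Fin.Subset.Properties using (nonempty?; Empty-unique; ∉⊥)
open import Data.Rational using (ℚ; 0ℚ; 1ℚ; _+_; _-_; -_; 1/_; _≤_; _<_) renaming (_*_ to _*ℚ_)
import Data.Rational as ℚ
import Data.Rational.Properties as ℚ
import Algebra.Properties.CommutativeSemigroup as CommutativeSemigroupProperties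
open import Algebra.Bundles using (CommutativeMonoid)
open import Relation.Binary.Core using (Rel)
open import Relation.Binary.Definitions using (tri<; tri≈; tri>)
open import Relation.Binary.PropositionalEquality
open import Relation.Nullary using (¬_; Dec; yes; no; does)
open import Relation.Nullary.Decidable using (from-yes; dec-true; dec-false; _×-dec_; _⊎-dec_; _→-dec_; ¬?)
open import Function using (_∘_; flip)
open import Function.Bundles using (Inverse; Equivalence; mk⇔)
open import Function.Definitions using (Injective)

private
  variable
    k m n : ℕ

module +-Properties = CommutativeSemigroupProperties (CommutativeMonoid.commutativeSemigroup ℚ.+-0-commutativeMonoid)
module *-Properties = CommutativeSemigroupProperties (CommutativeMonoid.commutativeSemigroup ℚ.*-1-commutativeMonoid)

*-cancelˡ-pos : ∀ {b p q} → 0ℚ < b → b *ℚ p ≡ b *ℚ q → p ≡ q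
*-cancelˡ-pos {b} {p} {q} 0<b bp≡bq = trans (divide p) (trans (cong (1/ b *ℚ_) bp≡bq) (sym (divide q)))
  where
    instance _ = ℚ.>-nonZero 0<b
    divide : ∀ r → r ≡ 1/ b *ℚ (b *ℚ r)
    divide r = begin
      r                  ≡⟨ sym (ℚ.*-identityˡ r) ⟩
      1ℚ *ℚ r            ≡⟨ cong (_*ℚ r) (sym (ℚ.*-inverseˡ b)) ⟩
      (1/ b *ℚ b) *ℚ r   ≡⟨ ℚ.*-assoc (1/ b) b r ⟩
      1/ b *ℚ (b *ℚ r)   ∎
      where open ≡-Reasoning

+-self-≰ : ∀ {b} → 0ℚ < b → ¬ b + b ≤ b
+-self-≰ {b} 0<b b+b≤b =
  ℚ.<-irrefl refl (ℚ.<-≤-trans (subst (_< b + b) (ℚ.+-identityʳ b) (ℚ.+-monoʳ-< b 0<b)) b+b≤b)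

sumFin-cong : {f g : Vecℚ n} → f ≗ g → sumFin f ≡ sumFin g
sumFin-cong {zero}  f≗g = refl
sumFin-cong {suc n} f≗g = cong₂ _+_ (f≗g F.zero) (sumFin-cong (f≗g ∘ F.suc))

sumFin-zero : (f : Vecℚ n) → (∀ i → f i ≡ 0ℚ) → sumFin f ≡ 0ℚ
sumFin-zero {zero}  f f≗0 = refl
sumFin-zero {suc n} f f≗0 = cong₂ _+_ (f≗0 F.zero) (sumFin-zero (f ∘ F.suc) (f≗0 ∘ F.suc))

sumFin-single : (f : Vecℚ n) (j : Fin n) → (∀ i → i ≢ j → f i ≡ 0ℚ) → sumFin f ≡ f j
sumFin-single f F.zero    f≗0 =
  trans (cong (f F.zero +_) (sumFin-zero (f ∘ F.suc) (λ i → f≗0 (F.suc i) λ ()))) (ℚ.+-identityʳ (f F.zero))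
sumFin-single f (F.suc j) f≗0 =
  trans (cong₂ _+_ (f≗0 F.zero λ ()) refl)
    (trans (ℚ.+-identityˡ _) (sumFin-single (f ∘ F.suc) j (λ i i≢j → f≗0 (F.suc i) (i≢j ∘ suc-injective))))

sumFin-+ : (f g : Vecℚ n) → sumFin (λ i → f i + g i) ≡ sumFin f + sumFin g
sumFin-+ {zero}  f g = refl
sumFin-+ {suc n} f g =
  trans (cong (f F.zero + g F.zero +_) (sumFin-+ (f ∘ F.suc) (g ∘ F.suc)))
    (+-Properties.interchange (f F.zero) (g F.zero) (sumFin (f ∘ F.suc)) (sumFin (g ∘ F.suc)))

sumFin-- : (f g : Vecℚ n) → sumFin (λ i → f i - g i) ≡ sumFin f - sumFin g
sumFin-- {zero}  f g = refl
sumFin-- {suc n} f g =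
  trans (cong (f F.zero - g F.zero +_) (sumFin-- (f ∘ F.suc) (g ∘ F.suc)))
    (trans (+-Properties.interchange (f F.zero) (- g F.zero) (sumFin (f ∘ F.suc)) (- sumFin (g ∘ F.suc)))
      (cong (f F.zero + sumFin (f ∘ F.suc) +_) (sym (ℚ.neg-distrib-+ (g F.zero) (sumFin (g ∘ F.suc))))))

sumFin-*ˡ : (c : ℚ) (f : Vecℚ n) → sumFin (λ i → c *ℚ f i) ≡ c *ℚ sumFin f
sumFin-*ˡ {zero}  c f = sym (ℚ.*-zeroʳ c)
sumFin-*ˡ {suc n} c f =
  trans (cong (c *ℚ f F.zero +_) (sumFin-*ˡ c (f ∘ F.suc))) (sym (ℚ.*-distribˡ-+ c (f F.zero) (sumFin (f ∘ F.suc))))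

sumFin-neg : (f : Vecℚ n) → sumFin (λ i → - f i) ≡ - sumFin f
sumFin-neg {zero}  f = refl
sumFin-neg {suc n} f =
  trans (cong (- f F.zero +_) (sumFin-neg (f ∘ F.suc))) (sym (ℚ.neg-distrib-+ (f F.zero) (sumFin (f ∘ F.suc))))

sumFin-swap : (f : Fin m → Fin n → ℚ) →
              sumFin (λ i → sumFin (λ j → f i j)) ≡ sumFin (λ j → sumFin (λ i → f i j))
sumFin-swap {zero}  f = sym (sumFin-zero (λ j → sumFin (λ i → f i j)) (λ _ → refl))
sumFin-swap {suc m} f =
  trans (cong (sumFin (f F.zero) +_) (sumFin-swap (f ∘ F.suc))) (sym (sumFin-+ (f F.zero) (λ j → sumFin (λ i → f (F.suc i) j))))

sumFin-↑ : (f : Vecℚ (m ℕ.+ n)) → sumFin f ≡ sumFin (λ i → f (i ↑ˡ n)) + sumFin (λ i → f (m ↑ʳ i))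
sumFin-↑ {zero}  f = sym (ℚ.+-identityˡ (sumFin f))
sumFin-↑ {suc m} {n} f = trans (cong (f F.zero +_) (sumFin-↑ {m} {n} (f ∘ F.suc))) (sym (ℚ.+-assoc (f F.zero) (sumFin (λ i → f (F.suc (i ↑ˡ n)))) _))

sumFin-combine : (f : Vecℚ (k * n)) → sumFin f ≡ sumFin {k} (λ m → sumFin {n} (λ z → f (combine m z)))
sumFin-combine {zero}      f = refl
sumFin-combine {suc k} {n} f =
  trans (sumFin-↑ {n} f) (cong (sumFin (λ z → f (z ↑ˡ (k * n))) +_) (sumFin-combine {k} {n} (λ i → f (n ↑ʳ i))))

unit : Fin n → Vecℚ n
unit j i = if does (i F.≟ j) then 1ℚ else 0ℚ

unit-same : (j : Fin n) → unit j j ≡ 1ℚ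
unit-same j with j F.≟ j
... | yes _  = refl
... | no j≢j = ⊥-elim (j≢j refl)

unit-other : {i j : Fin n} → i ≢ j → unit j i ≡ 0ℚ
unit-other {i = i} {j} i≢j with i F.≟ j
... | yes i≡j = ⊥-elim (i≢j i≡j)
... | no _    = refl

sumFin-unit : (j : Fin n) → sumFin (unit j) ≡ 1ℚ
sumFin-unit j = trans (sumFin-single (unit j) j (λ _ → unit-other)) (unit-same j)

·-comm : (u v : Vecℚ n) → u · v ≡ v · u
·-comm u v = sumFin-cong (λ i → ℚ.*-comm (u i) (v i))

·-congˡ : {u u' : Vecℚ n} (v : Vecℚ n) → u ≗ u' → u · v ≡ u' · v
·-congˡ v u≗u' = sumFin-cong (λ i → cong (_*ℚ v i) (u≗u' i))

·-congʳ : (u : Vecℚ n) {v v' : Vecℚ n} → v ≗ v' → u · v ≡ u · v'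
·-congʳ u v≗v' = sumFin-cong (λ i → cong (u i *ℚ_) (v≗v' i))

·-zeroʳ : (u : Vecℚ n) {v : Vecℚ n} → (∀ i → v i ≡ 0ℚ) → u · v ≡ 0ℚ
·-zeroʳ u {v} v≗0 = sumFin-zero (λ i → u i *ℚ v i) (λ i → trans (cong (u i *ℚ_) (v≗0 i)) (ℚ.*-zeroʳ (u i)))

·-zeroˡ : {u : Vecℚ n} → (∀ i → u i ≡ 0ℚ) → (v : Vecℚ n) → u · v ≡ 0ℚ
·-zeroˡ {u = u} u≗0 v = trans (·-comm u v) (·-zeroʳ v u≗0)

·-unitʳ : (u : Vecℚ n) (j : Fin n) → u · unit j ≡ u j
·-unitʳ u j = trans (sumFin-single _ j (λ i i≢j → trans (cong (u i *ℚ_) (unit-other i≢j)) (ℚ.*-zeroʳ (u i))))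
                    (trans (cong (u j *ℚ_) (unit-same j)) (ℚ.*-identityʳ (u j)))

·-unitˡ : (j : Fin n) (u : Vecℚ n) → unit j · u ≡ u j
·-unitˡ j u = trans (·-comm (unit j) u) (·-unitʳ u j)

·-*ˡ : (c : ℚ) (u v : Vecℚ n) → (λ i → c *ℚ u i) · v ≡ c *ℚ (u · v)
·-*ˡ c u v = trans (sumFin-cong (λ i → ℚ.*-assoc c (u i) (v i))) (sumFin-*ˡ c (λ i → u i *ℚ v i))

·-+ʳ : (u v w : Vecℚ n) → u · (λ i → v i + w i) ≡ u · v + u · w
·-+ʳ u v w = trans (sumFin-cong (λ i → ℚ.*-distribˡ-+ (u i) (v i) (w i))) (sumFin-+ (λ i → u i *ℚ v i) (λ i → u i *ℚ w i))

·-negʳ : (u v : Vecℚ n) → u · neg v ≡ - (u · v)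
·-negʳ u v = trans (sumFin-cong (λ i → sym (ℚ.neg-distribʳ-* (u i) (v i)))) (sumFin-neg (λ i → u i *ℚ v i))

·-linearʳ : (u : Vecℚ n) (c : Vecℚ m) (v : Fin m → Vecℚ n) →
            u · (λ i → sumFin (λ j → c j *ℚ v j i)) ≡ sumFin (λ j → c j *ℚ (u · v j))
·-linearʳ u c v = begin
  sumFin (λ i → u i *ℚ sumFin (λ j → c j *ℚ v j i))    ≡⟨ sumFin-cong (λ i → sym (sumFin-*ˡ (u i) (λ j → c j *ℚ v j i))) ⟩
  sumFin (λ i → sumFin (λ j → u i *ℚ (c j *ℚ v j i)))  ≡⟨ sumFin-cong (λ i → sumFin-cong (λ j → *-Properties.x∙yz≈y∙xz (u i) (c j) (v j i))) ⟩
  sumFin (λ i → sumFin (λ j → c j *ℚ (u i *ℚ v j i)))  ≡⟨ sumFin-swap (λ i j → c j *ℚ (u i *ℚ v j i)) ⟩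
  sumFin (λ j → sumFin (λ i → c j *ℚ (u i *ℚ v j i)))  ≡⟨ sumFin-cong (λ j → sumFin-*ˡ (c j) (λ i → u i *ℚ v j i)) ⟩
  sumFin (λ j → c j *ℚ (u · v j))                      ∎
  where open ≡-Reasoning

·-linearˡ : (c : Vecℚ m) (v : Fin m → Vecℚ n) (u : Vecℚ n) →
            (λ i → sumFin (λ j → c j *ℚ v j i)) · u ≡ sumFin (λ j → c j *ℚ (v j · u))
·-linearˡ c v u =
  trans (·-comm _ u) (trans (·-linearʳ u c v) (sumFin-cong (λ j → cong (c j *ℚ_) (·-comm u (v j)))))

_↾_ : {A : Set} → Vector A (k * n) → Fin k → Vector A n
(x ↾ m) z = x (combine m z)

concat-combine : {A : Set} (xss : Vector (Vector A n) k) (m : Fin k) (z : Fin n) →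
                 concat xss (combine m z) ≡ xss m z
concat-combine xss m z = cong (uncurry (flip xss) ∘ swap) (remQuot-combine m z)

combine-elim : {P : Fin (k * n) → Set} → (∀ m z → P (combine m z)) → ∀ i → P i
combine-elim {k} {n} p i with combine-surjective {k} {n} i
... | m , z , refl = p m z

·-blocks : (a x : Vecℚ (k * n)) → a · x ≡ sumFin {k} (λ m → (a ↾ m) · (x ↾ m))
·-blocks {k} {n} a x = sumFin-combine {k} {n} (λ i → a i *ℚ x i)

AtBlock : Vecℚ (k * n) → Fin k → Vecℚ n → Set
AtBlock x m w = (∀ m' → m' ≢ m → ∀ z → x (combine m' z) ≡ 0ℚ) × (∀ z → x (combine m z) ≡ w z)

·-AtBlock : {x : Vecℚ (k * n)} {m : Fin k} {w : Vecℚ n} (a : Vecℚ (k * n)) → AtBlock x m w → a · x ≡ (a ↾ m) · w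
·-AtBlock {k} {n} {x = x} {m} a (outside-m , inside-m) =
  trans (·-blocks {k} {n} a x)
    (trans (sumFin-single _ m (λ m' m'≢m → ·-zeroʳ (a ↾ m') (outside-m m' m'≢m)))
      (·-congʳ (a ↾ m) inside-m))

AtBlock-unique : {x x' : Vecℚ (k * n)} {m : Fin k} {w : Vecℚ n} → AtBlock x m w → AtBlock x' m w → x ≗ x'
AtBlock-unique {x = x} {x'} {m} (x-out , x-in) (x'-out , x'-in) = combine-elim same
  where
    same : ∀ m' z → x (combine m' z) ≡ x' (combine m' z)
    same m' z with m' F.≟ m
    ... | yes refl   = trans (x-in z) (sym (x'-in z))
    ... | no m'≢m    = trans (x-out m' m'≢m z) (sym (x'-out m' m'≢m z))

sumFin-AtBlock : (c : Vecℚ (k * n)) (y : Fin (k * n) → Vecℚ (k * n)) (w : Fin k → Fin n → Vecℚ n) →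
                 (∀ m z → AtBlock (y (combine m z)) m (w m z)) → ∀ m z' →
                 sumFin (λ j → c j *ℚ y j (combine m z')) ≡ sumFin (λ z → c (combine m z) *ℚ w m z z')
sumFin-AtBlock {k} {n} c y w at m z' =
  trans (sumFin-combine {k} {n} (λ j → c j *ℚ y j (combine m z')))
    (trans (sumFin-single _ m (λ m' m'≢m → sumFin-zero _ (λ z →
              trans (cong (c (combine m' z) *ℚ_) (proj₁ (at m' z) m (m'≢m ∘ sym) z')) (ℚ.*-zeroʳ (c (combine m' z))))))
      (sumFin-cong (λ z → cong (c (combine m z) *ℚ_) (proj₂ (at m z) z'))))

signed : Bool → Vecℚ n → Vecℚ n
signed true  x = x
signed false x = neg x

AtBlock-signed : {x : Vecℚ (k * n)} {m : Fin k} {w : Vecℚ n} (s : Bool) → AtBlock x m w → AtBlock (signed s x) m (signed s w)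
AtBlock-signed true  at             = at
AtBlock-signed false (x-out , x-in) = (λ m' m'≢m z → cong -_ (x-out m' m'≢m z)) , (λ z → cong -_ (x-in z))

-- The hexagon Γ(I₂, I₂)

isPositive : Fin 6 → Bool
isPositive 0F = true
isPositive 1F = true
isPositive 2F = true
isPositive 3F = false
isPositive 4F = false
isPositive 5F = false

vertexSet : Fin 6 → Subset 2
vertexSet 0F = inside  ∷ outside ∷ []
vertexSet 1F = inside  ∷ inside  ∷ []
vertexSet 2F = outside ∷ inside  ∷ []
vertexSet 3F = inside  ∷ outside ∷ []
vertexSet 4F = inside  ∷ inside  ∷ []
vertexSet 5F = outside ∷ inside  ∷ []

-- The vertices ±ρ(S), ∅ ≠ S ⊆ I₂, of Γ(I₂, I₂), numbered counterclockwise from (1, 0).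
vertex : Fin 6 → Vecℚ 2
vertex v = signed (isPositive v) (ρ (vertexSet v))

vertex-of : (s : Bool) (S : Subset 2) → Nonempty S → ∃ λ v → isPositive v ≡ s × vertexSet v ≡ S
vertex-of s     (outside ∷ outside ∷ []) (_ , i∈S) = ⊥-elim (∉⊥ i∈S)
vertex-of true  (inside  ∷ outside ∷ []) _ = 0F , refl , refl
vertex-of true  (inside  ∷ inside  ∷ []) _ = 1F , refl , refl
vertex-of true  (outside ∷ inside  ∷ []) _ = 2F , refl , refl
vertex-of false (inside  ∷ outside ∷ []) _ = 3F , refl , refl
vertex-of false (inside  ∷ inside  ∷ []) _ = 4F , refl , refl
vertex-of false (outside ∷ inside  ∷ []) _ = 5F , refl , refl

next : Fin 6 → Fin 6
next 0F = 1F
next 1F = 2F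
next 2F = 3F
next 3F = 4F
next 4F = 5F
next 5F = 0F

parity : Fin 6 → Fin 2
parity 0F = 0F
parity 1F = 1F
parity 2F = 0F
parity 3F = 1F
parity 4F = 0F
parity 5F = 1F

edge : Fin 6 → Fin 2 → Fin 6
edge s 0F = s
edge s 1F = next s

Adjacent : Fin 6 → Fin 6 → Set
Adjacent v w = ∃ λ s → (edge s 0F ≡ v × edge s 1F ≡ w) ⊎ (edge s 0F ≡ w × edge s 1F ≡ v)

adjacent? : ∀ v w → Dec (Adjacent v w)
adjacent? v w = any? λ s → ((edge s 0F F.≟ v) ×-dec (edge s 1F F.≟ w)) ⊎-dec ((edge s 0F F.≟ w) ×-dec (edge s 1F F.≟ v))

vec₂ : ℚ → ℚ → Vecℚ 2
vec₂ x y 0F = x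
vec₂ x y 1F = y

-- The basis of ℚ² dual to the two endpoints of edge s.
edgeDual : Fin 6 → Fin 2 → Vecℚ 2
edgeDual 0F 0F = vec₂ 1ℚ (- 1ℚ)
edgeDual 0F 1F = vec₂ 0ℚ 1ℚ
edgeDual 1F 0F = vec₂ 1ℚ 0ℚ
edgeDual 1F 1F = vec₂ (- 1ℚ) 1ℚ
edgeDual 2F 0F = vec₂ 0ℚ 1ℚ
edgeDual 2F 1F = vec₂ (- 1ℚ) 0ℚ
edgeDual 3F 0F = vec₂ (- 1ℚ) 1ℚ
edgeDual 3F 1F = vec₂ 0ℚ (- 1ℚ)
edgeDual 4F 0F = vec₂ (- 1ℚ) 0ℚ
edgeDual 4F 1F = vec₂ 1ℚ (- 1ℚ)
edgeDual 5F 0F = vec₂ 0ℚ (- 1ℚ)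
edgeDual 5F 1F = vec₂ 1ℚ 0ℚ

-- Being the sum of the dual basis, normal s takes the value 1 at both endpoints of edge s.
normal : Fin 6 → Vecℚ 2
normal s i = sumFin (λ z → edgeDual s z i)

opaque
  normal-valid : ∀ s v → normal s · vertex v ≤ 1ℚ
  normal-valid = from-yes (all? λ s → all? λ v → normal s · vertex v ℚ.≤? 1ℚ)

  normal-tight : ∀ s z → normal s · vertex (edge s z) ≡ 1ℚ
  normal-tight = from-yes (all? λ s → all? λ z → normal s · vertex (edge s z) ℚ.≟ 1ℚ)

  normal-separates : ∀ s s' → s ≢ s' → ∃ λ v → normal s · vertex v ≡ 1ℚ × normal s' · vertex v ≢ 1ℚ
  normal-separates = from-yes (all? λ s → all? λ s' → ¬? (s F.≟ s') →-dec
    any? λ v → (normal s · vertex v ℚ.≟ 1ℚ) ×-dec ¬? (normal s' · vertex v ℚ.≟ 1ℚ))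

  nonadjacent-sum : ∀ v w → v ≢ w → ¬ Adjacent v w →
    (∃ λ u → ∀ i → vertex u i ≡ vertex v i + vertex w i) ⊎ (∀ i → vertex v i + vertex w i ≡ 0ℚ)
  nonadjacent-sum = from-yes (all? λ v → all? λ w → ¬? (v F.≟ w) →-dec ¬? (adjacent? v w) →-dec
    ((any? λ u → all? λ i → vertex u i ℚ.≟ vertex v i + vertex w i) ⊎-dec (all? λ i → vertex v i + vertex w i ℚ.≟ 0ℚ)))

  adjacent-parity : ∀ v w → Adjacent v w → parity v ≢ parity w
  adjacent-parity = from-yes (all? λ v → all? λ w → adjacent? v w →-dec ¬? (parity v F.≟ parity w))

  axis-vertices : ∀ i → ∃₂ λ v w → (∀ j → vertex v j ≡ unit i j) × (∀ j → vertex w j ≡ - unit i j)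
  axis-vertices = from-yes (all? λ i → any? λ v → any? λ w →
    all? (λ j → vertex v j ℚ.≟ unit i j) ×-dec all? (λ j → vertex w j ℚ.≟ - unit i j))

  edgeDual-biorthogonal : ∀ s z z' → vertex (edge s z') · edgeDual s z ≡ unit z z'
  edgeDual-biorthogonal = from-yes (all? λ s → all? λ z → all? λ z' → vertex (edge s z') · edgeDual s z ℚ.≟ unit z z')

  edgeDual-spans : ∀ s i i' → sumFin (λ z → edgeDual s z i *ℚ vertex (edge s z) i') ≡ unit i i'
  edgeDual-spans = from-yes (all? λ s → all? λ i → all? λ i' →
    sumFin (λ z → edgeDual s z i *ℚ vertex (edge s z) i') ℚ.≟ unit i i')

hexagon-spanning : (u : Vecℚ 2) → (∀ v → u · vertex v ≤ 0ℚ) → ∀ i → u i ≡ 0ℚ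
hexagon-spanning u u≤0 i with axis-vertices i
... | v , w , v≗eᵢ , w≗-eᵢ = ℚ.≤-antisym uᵢ≤0 (subst (0ℚ ≤_) (neg-involutive (u i)) (ℚ.neg-antimono-≤ -uᵢ≤0))
  where
    open import Algebra.Properties.Group ℚ.+-0-group using () renaming (⁻¹-involutive to neg-involutive)
    uᵢ≤0 : u i ≤ 0ℚ
    uᵢ≤0 = subst (_≤ 0ℚ) (trans (·-congʳ u v≗eᵢ) (·-unitʳ u i)) (u≤0 v)
    -uᵢ≤0 : - u i ≤ 0ℚ
    -uᵢ≤0 = subst (_≤ 0ℚ) (trans (·-congʳ u w≗-eᵢ) (trans (·-negʳ u (unit i)) (cong -_ (·-unitʳ u i)))) (u≤0 w)

edge-normal : ∀ s (u : Vecℚ 2) b → (∀ z → u · vertex (edge s z) ≡ b) → ∀ i → u i ≡ b *ℚ normal s i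
edge-normal s u b tight i = begin
  u i                                                          ≡⟨ ·-unitʳ u i ⟨
  u · unit i                                                   ≡⟨ ·-congʳ u (edgeDual-spans s i) ⟨
  u · (λ i' → sumFin (λ z → edgeDual s z i *ℚ vertex (edge s z) i'))
                                                               ≡⟨ ·-linearʳ u (λ z → edgeDual s z i) (vertex ∘ edge s) ⟩
  sumFin (λ z → edgeDual s z i *ℚ (u · vertex (edge s z)))     ≡⟨ sumFin-cong (λ z → trans (cong (edgeDual s z i *ℚ_) (tight z)) (ℚ.*-comm (edgeDual s z i) b)) ⟩
  sumFin (λ z → b *ℚ edgeDual s z i)                           ≡⟨ sumFin-*ˡ b (λ z → edgeDual s z i) ⟩
  b *ℚ normal s i                                              ∎
  where open ≡-Reasoning

edge-independent : ∀ s (c : Vecℚ 2) → (∀ i → sumFin (λ z → c z *ℚ vertex (edge s z) i) ≡ 0ℚ) → ∀ z → c z ≡ 0ℚ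
edge-independent s c dependent z = begin
  c z                                                            ≡⟨ ·-unitʳ c z ⟨
  c · unit z                                                     ≡⟨ sumFin-cong (λ z' → cong (c z' *ℚ_) (edgeDual-biorthogonal s z z')) ⟨
  sumFin (λ z' → c z' *ℚ (vertex (edge s z') · edgeDual s z))    ≡⟨ ·-linearˡ c (vertex ∘ edge s) (edgeDual s z) ⟨
  (λ i → sumFin (λ z' → c z' *ℚ vertex (edge s z') i)) · edgeDual s z
                                                                 ≡⟨ ·-comm (λ i → sumFin (λ z' → c z' *ℚ vertex (edge s z') i)) (edgeDual s z) ⟩
  edgeDual s z · (λ i → sumFin (λ z' → c z' *ℚ vertex (edge s z') i))
                                                                 ≡⟨ ·-zeroʳ (edgeDual s z) dependent ⟩
  0ℚ                                                             ∎
  where open ≡-Reasoning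

adjacent-tight⇒normal : ∀ (u : Vecℚ 2) b {v w} → Adjacent v w → u · vertex v ≡ b → u · vertex w ≡ b →
                        ∃ λ s → ∀ i → u i ≡ b *ℚ normal s i
adjacent-tight⇒normal u b (s , inj₁ (refl , refl)) tv tw = s , edge-normal s u b λ { 0F → tv ; 1F → tw }
adjacent-tight⇒normal u b (s , inj₂ (refl , refl)) tv tw = s , edge-normal s u b λ { 0F → tw ; 1F → tv }

tight-distinct⇒adjacent : ∀ (u : Vecℚ 2) {b} → 0ℚ < b → (∀ v → u · vertex v ≤ b) →
                          ∀ {v w} → u · vertex v ≡ b → u · vertex w ≡ b → v ≢ w → Adjacent v w
tight-distinct⇒adjacent u {b} 0<b valid {v} {w} tv tw v≢w with adjacent? v w
... | yes adjacent = adjacent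
... | no nonadjacent = ⊥-elim (+-self-≰ 0<b b+b≤b)
  where
    u·[v+w] : u · (λ i → vertex v i + vertex w i) ≡ b + b
    u·[v+w] = trans (·-+ʳ u (vertex v) (vertex w)) (cong₂ _+_ tv tw)
    b+b≤b : b + b ≤ b
    b+b≤b with nonadjacent-sum v w v≢w nonadjacent
    ... | inj₁ (x , x≗v+w) = subst (_≤ b) (trans (·-congʳ u x≗v+w) u·[v+w]) (valid x)
    ... | inj₂ v+w≗0       = subst (_≤ b) (trans (sym (·-zeroʳ u v+w≗0)) u·[v+w]) (ℚ.<⇒≤ 0<b)

-- Antichains of a poset isomorphic to I₂ ⊕ ⋯ ⊕ I₂

Incomparable : {C : Set} → Rel C 0ℓ → C → C → Set
Incomparable _≤_ x y = x ≢ y × ¬ x ≤ y × ¬ y ≤ x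

Incomparable-sym : {C : Set} {R : Rel C 0ℓ} {x y : C} → Incomparable R x y → Incomparable R y x
Incomparable-sym (x≢y , x≰y , y≰x) = x≢y ∘ sym , y≰x , x≰y

Fin2-≢-unique : {a b c : Fin 2} → a ≢ b → a ≢ c → b ≡ c
Fin2-≢-unique {0F} {0F}         a≢b _   = ⊥-elim (a≢b refl)
Fin2-≢-unique {0F} {1F} {0F}    _   a≢c = ⊥-elim (a≢c refl)
Fin2-≢-unique {0F} {1F} {1F}    _   _   = refl
Fin2-≢-unique {1F} {0F} {0F}    _   _   = refl
Fin2-≢-unique {1F} {0F} {1F}    _   a≢c = ⊥-elim (a≢c refl)
Fin2-≢-unique {1F} {1F}         a≢b _   = ⊥-elim (a≢b refl)

I₂ⁿ-incomparable-unique : ∀ k {u v w : I₂ⁿ-carrier k} →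
                          Incomparable (I₂ⁿ-rel k) u v → Incomparable (I₂ⁿ-rel k) u w → v ≡ w
I₂ⁿ-incomparable-unique zero {()}
I₂ⁿ-incomparable-unique (suc k) {inj₁ a} {inj₁ b} {inj₁ c} (a≢b , _) (a≢c , _) =
  cong inj₁ (Fin2-≢-unique (a≢b ∘ cong inj₁) (a≢c ∘ cong inj₁))
I₂ⁿ-incomparable-unique (suc k) {inj₁ _} {inj₂ _}          (_ , u≰v , _) _ = ⊥-elim (u≰v _)
I₂ⁿ-incomparable-unique (suc k) {inj₁ _} {inj₁ _} {inj₂ _} _ (_ , u≰w , _) = ⊥-elim (u≰w _)
I₂ⁿ-incomparable-unique (suc k) {inj₂ _} {inj₁ _}          (_ , _ , v≰u) _ = ⊥-elim (v≰u _)
I₂ⁿ-incomparable-unique (suc k) {inj₂ _} {inj₂ _} {inj₁ _} _ (_ , _ , w≰u) = ⊥-elim (w≰u _)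
I₂ⁿ-incomparable-unique (suc k) {inj₂ a} {inj₂ b} {inj₂ c} (a≢b , a≰b , b≰a) (a≢c , a≰c , c≰a) =
  cong inj₂ (I₂ⁿ-incomparable-unique k (a≢b ∘ cong inj₂ , a≰b , b≰a) (a≢c ∘ cong inj₂ , a≰c , c≰a))

module OrderIsoProperties {d} {P : FinPoset d} {C : Set} {R : Rel C 0ℓ} (iso : OrderIso P C R) where

  to : Fin d → C
  to = Inverse.to (proj₁ iso)

  to-injective : ∀ {x y} → to x ≡ to y → x ≡ y
  to-injective {x} {y} eq =
    trans (sym (Inverse.strictlyInverseʳ (proj₁ iso) x)) (trans (cong (Inverse.from (proj₁ iso)) eq) (Inverse.strictlyInverseʳ (proj₁ iso) y))

  to-incomparable : ∀ {x y} → InducedI₂ P x y → Incomparable R (to x) (to y)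
  to-incomparable {x} {y} (x≢y , x⋠y , y⋠x) =
    x≢y ∘ to-injective , x⋠y ∘ Equivalence.from (proj₂ iso x y) , y⋠x ∘ Equivalence.from (proj₂ iso y x)

blockSubset : Fin k → Subset 2 → Subset (k * 2)
blockSubset m S = tabulate (concat λ m' → if does (m' F.≟ m) then lookup S else λ _ → false)

blockSubset-combine : ∀ (m : Fin k) S m' z →
                      lookup (blockSubset m S) (combine m' z) ≡ (if does (m' F.≟ m) then lookup S else λ _ → false) z
blockSubset-combine {k} m S m' z = trans (lookup∘tabulate _ (combine m' z)) (concat-combine pieces m' z)
  where
    pieces : Fin k → Vector Bool 2
    pieces m' = if does (m' F.≟ m) then lookup S else λ _ → false

blockSubset-inside : ∀ (m : Fin k) S z → lookup (blockSubset m S) (combine m z) ≡ lookup S z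
blockSubset-inside m S z =
  trans (blockSubset-combine m S m z) (cong (λ b → (if b then lookup S else λ _ → false) z) (dec-true (m F.≟ m) refl))

blockSubset-outside : ∀ {m m' : Fin k} S z → m' ≢ m → lookup (blockSubset m S) (combine m' z) ≡ false
blockSubset-outside {m = m} {m'} S z m'≢m =
  trans (blockSubset-combine m S m' z) (cong (λ b → (if b then lookup S else λ _ → false) z) (dec-false (m' F.≟ m) m'≢m))

∈-blockSubset : ∀ {m m' : Fin k} {S z} → combine m' z ∈ blockSubset m S → m' ≡ m
∈-blockSubset {m = m} {m'} {S} {z} ∈S with m' F.≟ m
... | yes m'≡m = m'≡m
... | no m'≢m with () ← trans (sym ([]=⇒lookup ∈S)) (blockSubset-outside S z m'≢m)

ρ-blockSubset : ∀ (m : Fin k) S → AtBlock (ρ (blockSubset m S)) m (ρ S)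
ρ-blockSubset m S = (λ m' m'≢m z → cong (if_then 1ℚ else 0ℚ) (blockSubset-outside S z m'≢m)) ,
                    (λ z → cong (if_then 1ℚ else 0ℚ) (blockSubset-inside m S z))

ρ-⊥ : ∀ (i : Fin n) → ρ Sub.⊥ i ≡ 0ℚ
ρ-⊥ i = cong (if_then 1ℚ else 0ℚ) (lookup-replicate i outside)

slice : Subset (k * 2) → Fin k → Subset 2
slice A m = tabulate (λ z → lookup A (combine m z))

module _ (P : FinPoset (k * 2)) (blocks : ∀ (m : Fin k) → InducedI₂ P (combine m 0F) (combine m 1F)) where
  open FinPoset P

  block-partner : ∀ (m : Fin k) z → InducedI₂ P (combine m z) (combine m (F.opposite z))
  block-partner m 0F = blocks m
  block-partner m 1F = Incomparable-sym {R = _≼_} (blocks m)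

  block-comparable⇒equal : ∀ (m : Fin k) {z z'} → combine m z ≼ combine m z' → z ≡ z'
  block-comparable⇒equal m {0F} {0F} _   = refl
  block-comparable⇒equal m {0F} {1F} z≼z' = ⊥-elim (proj₁ (proj₂ (blocks m)) z≼z')
  block-comparable⇒equal m {1F} {0F} z≼z' = ⊥-elim (proj₂ (proj₂ (blocks m)) z≼z')
  block-comparable⇒equal m {1F} {1F} _   = refl

  blockSubset-antichain : ∀ m S → IsAntichain P (blockSubset m S)
  blockSubset-antichain m S x y x∈ y∈ x≼y with combine-surjective {k} {2} x | combine-surjective {k} {2} y
  ... | m₁ , z₁ , refl | m₂ , z₂ , refl with ∈-blockSubset {m = m} {m₁} {S} {z₁} x∈ | ∈-blockSubset {m = m} {m₂} {S} {z₂} y∈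
  ...   | refl | refl = cong (combine m) (block-comparable⇒equal m x≼y)

  ⊥-antichain : IsAntichain P Sub.⊥
  ⊥-antichain x _ x∈⊥ = ⊥-elim (∉⊥ x∈⊥)

  module _ (iso : OrderIso P (I₂ⁿ-carrier k) (I₂ⁿ-rel k)) where
    open OrderIsoProperties {P = P} {R = I₂ⁿ-rel k} iso

    antichain-within-block : ∀ {A} → IsAntichain P A → ∀ {m m' z z'} → combine m z ∈ A → combine m' z' ∈ A → m' ≡ m
    antichain-within-block {A} anti {m} {m'} {z} {z'} x∈ y∈ with m' F.≟ m
    ... | yes m'≡m = m'≡m
    ... | no m'≢m  = proj₁ (combine-injective m' z' m (F.opposite z) y≡partner)
      where
        x≢y : combine m z ≢ combine m' z'
        x≢y x≡y = m'≢m (sym (proj₁ (combine-injective m z m' z' x≡y)))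
        x∥y : InducedI₂ P (combine m z) (combine m' z')
        x∥y = x≢y , x≢y ∘ anti _ _ x∈ y∈ , x≢y ∘ sym ∘ anti _ _ y∈ x∈
        y≡partner : combine m' z' ≡ combine m (F.opposite z)
        y≡partner = to-injective (I₂ⁿ-incomparable-unique k (to-incomparable x∥y) (to-incomparable (block-partner m z)))

    antichain-ρ : ∀ {A} → IsAntichain P A →
                  (∀ i → ρ A i ≡ 0ℚ) ⊎ ∃₂ λ (m : Fin k) S → Nonempty S × AtBlock (ρ A) m (ρ S)
    antichain-ρ {A} anti with nonempty? A
    ... | no empty = inj₁ λ i → trans (cong (λ B → ρ B i) (Empty-unique empty)) (ρ-⊥ i)
    ... | yes (i , i∈A) with combine-surjective {k} {2} i
    ...   | m , z , refl = inj₂ (m , slice A m , (z , lookup⇒[]= z (slice A m) (trans (lookup∘tabulate (λ z → lookup A (combine m z)) z) ([]=⇒lookup i∈A))) ,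
                                 off-block , λ z' → cong (if_then 1ℚ else 0ℚ) (sym (lookup∘tabulate (λ z → lookup A (combine m z)) z')))
      where
        off-block : ∀ m' → m' ≢ m → ∀ z' → ρ A (combine m' z') ≡ 0ℚ
        off-block m' m'≢m z' with lookup A (combine m' z') in eq
        ... | false = refl
        ... | true  = ⊥-elim (m'≢m (antichain-within-block anti i∈A (lookup⇒[]= _ A eq)))

-- Facets of a free sum of hexagons

unit-difference-nonzero : {j j' : Fin n} → j ≢ j' → unit j j - unit j' j ≢ 0ℚ
unit-difference-nonzero {j = j} j≢j' eq rewrite unit-same j | unit-other j≢j' with () ← eq

affinelyIndependent⇒injective : {y : Fin m → Vecℚ n} → AffinelyIndependent y →
                                ∀ {j j'} → y j ≗ y j' → j ≡ j'
affinelyIndependent⇒injective {m} {y = y} independent {j} {j'} y≗ with j F.≟ j'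
... | yes j≡j' = j≡j'
... | no j≢j'  = ⊥-elim (unit-difference-nonzero j≢j' (independent c Σc≡0 Σcy≡0 j))
  where
    c : Vecℚ m
    c t = unit j t - unit j' t
    Σc≡0 : sumFin c ≡ 0ℚ
    Σc≡0 = trans (sumFin-- (unit j) (unit j')) (cong₂ _-_ (sumFin-unit j) (sumFin-unit j'))
    Σcy≡0 : ∀ i → sumFin (λ t → c t *ℚ y t i) ≡ 0ℚ
    Σcy≡0 i = begin
      sumFin (λ t → c t *ℚ y t i)                                ≡⟨ sumFin-cong (λ t → *-distribʳ-- (y t i) (unit j t) (unit j' t)) ⟩
      sumFin (λ t → unit j t *ℚ y t i - unit j' t *ℚ y t i)      ≡⟨ sumFin-- (λ t → unit j t *ℚ y t i) (λ t → unit j' t *ℚ y t i) ⟩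
      unit j · (λ t → y t i) - unit j' · (λ t → y t i)           ≡⟨ cong₂ _-_ (·-unitˡ j (λ t → y t i)) (·-unitˡ j' (λ t → y t i)) ⟩
      y j i - y j' i                                             ≡⟨ cong (_- y j' i) (y≗ i) ⟩
      y j' i - y j' i                                            ≡⟨ ℚ.+-inverseʳ (y j' i) ⟩
      0ℚ                                                         ∎
      where
        open ≡-Reasoning
        *-distribʳ-- : ∀ r p q → (p - q) *ℚ r ≡ p *ℚ r - q *ℚ r
        *-distribʳ-- r p q = trans (ℚ.*-distribʳ-+ r p (- q)) (cong (p *ℚ r +_) (sym (ℚ.neg-distribˡ-* q r)))

injective⇒surjective : (g : Fin n → Fin n) → Injective _≡_ _≡_ g → ∀ t → ∃ λ i → g i ≡ t
injective⇒surjective {suc n} g g-injective t with any? (λ i → g i F.≟ t)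
... | yes hit = hit
... | no miss = ⊥-elim (1+n≰n (injective⇒≤ avoid-t-injective))
  where
    avoid-t : Fin (suc n) → Fin n
    avoid-t i = punchOut {i = t} {j = g i} (λ t≡gi → miss (i , sym t≡gi))
    avoid-t-injective : Injective _≡_ _≡_ avoid-t
    avoid-t-injective = g-injective ∘ punchOut-injective {i = t} _ _

funToFin-cong : {f g : Fin m → Fin n} → f ≗ g → funToFin f ≡ funToFin g
funToFin-cong {zero}  f≗g = refl
funToFin-cong {suc m} f≗g = cong₂ combine (f≗g F.zero) (funToFin-cong (f≗g ∘ F.suc))

finToFun-injective : ∀ {base exponent} {i j : Fin (base ^ exponent)} → finToFun {base} {exponent} i ≗ finToFun j → i ≡ j
finToFun-injective {base} {exponent} {i} {j} i≗j =
  trans (sym (funToFin-finToFin {exponent} {base} i)) (trans (funToFin-cong i≗j) (funToFin-finToFin {exponent} {base} j))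

sameFace-scaled : {G : PointSet n} {a u : Vecℚ n} {b : ℚ} → 0ℚ < b → (∀ i → a i ≡ b *ℚ u i) →
                  SameFace G (a , b) (u , 1ℚ)
sameFace-scaled {a = a} {u} {b} 0<b a≗bu x _ = mk⇔
  (λ a·x≡b → *-cancelˡ-pos 0<b (trans (sym a·x≡b·u·x) (trans a·x≡b (sym (ℚ.*-identityʳ b)))))
  (λ u·x≡1 → trans a·x≡b·u·x (trans (cong (b *ℚ_) u·x≡1) (ℚ.*-identityʳ b)))
  where
    a·x≡b·u·x : a · x ≡ b *ℚ (u · x)
    a·x≡b·u·x = trans (·-congˡ x a≗bu) (·-*ˡ b u x)

record FreeSumOfHexagons (G : PointSet (k * 2)) : Set₁ where
  field
    origin   : ∃ λ x → G x × (∀ i → x i ≡ 0ℚ)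
    vertexAt : ∀ (m : Fin k) v → ∃ λ x → G x × AtBlock x m (vertex v)
    classify : ∀ x → G x → (∀ i → x i ≡ 0ℚ) ⊎ ∃₂ λ (m : Fin k) v → AtBlock x m (vertex v)

module _ {k : ℕ} {G : PointSet (k * 2)} (hexagons : FreeSumOfHexagons {k} G) where
  open FreeSumOfHexagons hexagons

  facetNormal : (Fin k → Fin 6) → Vecℚ (k * 2)
  facetNormal σ = concat (normal ∘ σ)

  facetNormal-AtBlock : ∀ σ {x m w} → AtBlock x m w → facetNormal σ · x ≡ normal (σ m) · w
  facetNormal-AtBlock σ {m = m} {w} at = trans (·-AtBlock (facetNormal σ) at) (·-congˡ w (concat-combine (normal ∘ σ) m))

  facetNormal-cong : ∀ {σ σ'} → σ ≗ σ' → facetNormal σ ≗ facetNormal σ'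
  facetNormal-cong {σ} {σ'} σ≗σ' = combine-elim λ m z →
    trans (concat-combine (normal ∘ σ) m z) (trans (cong (λ s → normal s z) (σ≗σ' m)) (sym (concat-combine (normal ∘ σ') m z)))

  edgePoints : (Fin k → Fin 6) → Fin (k * 2) → Vecℚ (k * 2)
  edgePoints σ = concat (λ m z → proj₁ (vertexAt m (edge (σ m) z)))

  edgePoints-combine : ∀ σ m z → G (edgePoints σ (combine m z)) × AtBlock (edgePoints σ (combine m z)) m (vertex (edge (σ m) z))
  edgePoints-combine σ m z =
    subst (λ x → G x × AtBlock x m (vertex (edge (σ m) z))) (sym (concat-combine (λ m z → proj₁ (vertexAt m (edge (σ m) z))) m z)) (proj₂ (vertexAt m (edge (σ m) z)))

  facetNormal-isFacet : ∀ σ → IsFacetIneq G (facetNormal σ) 1ℚ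
  facetNormal-isFacet σ = valid , below , (edgePoints σ , combine-elim on-facet , independent)
    where
      below : ∃ λ x → G x × facetNormal σ · x < 1ℚ
      below with origin
      ... | x₀ , Gx₀ , x₀≗0 = x₀ , Gx₀ , subst (_< 1ℚ) (sym (·-zeroʳ (facetNormal σ) x₀≗0)) (from-yes (0ℚ ℚ.<? 1ℚ))
      valid : ∀ x → G x → facetNormal σ · x ≤ 1ℚ
      valid x Gx with classify x Gx
      ... | inj₁ x≗0           = subst (_≤ 1ℚ) (sym (·-zeroʳ (facetNormal σ) x≗0)) (from-yes (0ℚ ℚ.≤? 1ℚ))
      ... | inj₂ (m , v , at)  = subst (_≤ 1ℚ) (sym (facetNormal-AtBlock σ at)) (normal-valid (σ m) v)
      on-facet : ∀ m z → G (edgePoints σ (combine m z)) × facetNormal σ · edgePoints σ (combine m z) ≡ 1ℚ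
      on-facet m z with edgePoints-combine σ m z
      ... | Gx , at = Gx , trans (facetNormal-AtBlock σ at) (normal-tight (σ m) z)
      independent : AffinelyIndependent (edgePoints σ)
      independent c _ dependent = combine-elim λ m → edge-independent (σ m) (c ↾ m) λ z' →
        trans (sym (sumFin-AtBlock c (edgePoints σ) (λ m z → vertex (edge (σ m) z)) (λ m z → proj₂ (edgePoints-combine σ m z)) m z'))
              (dependent (combine m z'))

  facetNormal-distinct : ∀ σ σ' m → σ m ≢ σ' m → ¬ SameFace G (facetNormal σ , 1ℚ) (facetNormal σ' , 1ℚ)
  facetNormal-distinct σ σ' m σm≢σ'm same with normal-separates (σ m) (σ' m) σm≢σ'm
  ... | v , on-σ , off-σ' with vertexAt m v
  ...   | x , Gx , at = off-σ' (trans (sym (facetNormal-AtBlock σ' at))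
                                  (Equivalence.to (same x Gx) (trans (facetNormal-AtBlock σ at) on-σ)))

  module _ {a : Vecℚ (k * 2)} {b : ℚ} (valid : ∀ x → G x → a · x ≤ b) where

    block-valid : ∀ m v → (a ↾ m) · vertex v ≤ b
    block-valid m v with vertexAt m v
    ... | x , Gx , at = subst (_≤ b) (·-AtBlock a at) (valid x Gx)

    offset-positive : ∀ {x₀} → G x₀ → a · x₀ < b → 0ℚ < b
    offset-positive {x₀} Gx₀ a·x₀<b with ℚ.<-cmp 0ℚ b | origin
    ... | tri< 0<b _ _ | _ = 0<b
    ... | tri> _ _ b<0 | o , Go , o≗0 = ⊥-elim (ℚ.<-irrefl refl (ℚ.<-≤-trans b<0 (subst (_≤ b) (·-zeroʳ a o≗0) (valid o Go))))
    ... | tri≈ _ refl _ | _ = ⊥-elim (ℚ.<-irrefl (·-zeroˡ a≗0 x₀) a·x₀<b)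
      where
        a≗0 : ∀ i → a i ≡ 0ℚ
        a≗0 = combine-elim λ m → hexagon-spanning (a ↾ m) (block-valid m)

    Tight : Fin k → Fin 6 → Set
    Tight m v = (a ↾ m) · vertex v ≡ b

    module _ (0<b : 0ℚ < b) {y : Fin (k * 2) → Vecℚ (k * 2)}
             (on-facet : ∀ j → G (y j) × a · y j ≡ b) (independent : AffinelyIndependent y) where

      located : ∀ j → ∃₂ λ (m : Fin k) v → AtBlock (y j) m (vertex v)
      located j with classify (y j) (proj₁ (on-facet j))
      ... | inj₂ at   = at
      ... | inj₁ y≗0  = ⊥-elim (ℚ.<⇒≢ 0<b (trans (sym (·-zeroʳ a y≗0)) (proj₂ (on-facet j))))

      blockOf : Fin (k * 2) → Fin k
      blockOf j = proj₁ (located j)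

      vertexOf : Fin (k * 2) → Fin 6
      vertexOf j = proj₁ (proj₂ (located j))

      vertexOf-tight : ∀ j → Tight (blockOf j) (vertexOf j)
      vertexOf-tight j = trans (sym (·-AtBlock a (proj₂ (proj₂ (located j))))) (proj₂ (on-facet j))

      tight-adjacent : ∀ {m v w} → Tight m v → Tight m w → v ≢ w → Adjacent v w
      tight-adjacent {m} = tight-distinct⇒adjacent (a ↾ m) 0<b (block-valid m)

      -- Two tight vertices in one block are adjacent, so they differ in parity: this labelling is
      -- injective, and therefore hits both parities in every block.
      parityLabel : Fin (k * 2) → Fin (k * 2)
      parityLabel j = combine (blockOf j) (parity (vertexOf j))

      parityLabel-injective : Injective _≡_ _≡_ parityLabel
      parityLabel-injective {j} {j'} eq with combine-injective (blockOf j) _ (blockOf j') _ eq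
      ... | same-block , same-parity with vertexOf j F.≟ vertexOf j'
      ...   | yes same-vertex = affinelyIndependent⇒injective independent (AtBlock-unique at-j (proj₂ (proj₂ (located j'))))
        where
          at-j : AtBlock (y j) (blockOf j') (vertex (vertexOf j'))
          at-j = subst₂ (λ m v → AtBlock (y j) m (vertex v)) same-block same-vertex (proj₂ (proj₂ (located j)))
      ...   | no differ = ⊥-elim (adjacent-parity _ _ (tight-adjacent tight-j (vertexOf-tight j') differ) same-parity)
        where
          tight-j : Tight (blockOf j') (vertexOf j)
          tight-j = subst (λ m → Tight m (vertexOf j)) same-block (vertexOf-tight j)

      block-normal : ∀ m → ∃ λ s → ∀ z → a (combine m z) ≡ b *ℚ normal s z
      block-normal m with injective⇒surjective parityLabel parityLabel-injective (combine m 0F)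
                        | injective⇒surjective parityLabel parityLabel-injective (combine m 1F)
      ... | j₀ , hit₀ | j₁ , hit₁ with combine-injective (blockOf j₀) _ m 0F hit₀ | combine-injective (blockOf j₁) _ m 1F hit₁
      ...   | in-m₀ , parity₀ | in-m₁ , parity₁ = adjacent-tight⇒normal (a ↾ m) b (tight-adjacent tight₀ tight₁ distinct) tight₀ tight₁
        where
          tight₀ : Tight m (vertexOf j₀)
          tight₀ = subst (λ m → Tight m (vertexOf j₀)) in-m₀ (vertexOf-tight j₀)
          tight₁ : Tight m (vertexOf j₁)
          tight₁ = subst (λ m → Tight m (vertexOf j₁)) in-m₁ (vertexOf-tight j₁)
          distinct : vertexOf j₀ ≢ vertexOf j₁
          distinct same = 0≢1+n (trans (sym parity₀) (trans (cong parity same) parity₁))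

  facet-classification : ∀ {a b} → IsFacetIneq G a b → ∃ λ σ → 0ℚ < b × (∀ i → a i ≡ b *ℚ facetNormal σ i)
  facet-classification {a} {b} (valid , (x₀ , Gx₀ , a·x₀<b) , (y , on-facet , independent)) =
    σ , 0<b , combine-elim λ m z → trans (proj₂ (normal-at m) z) (cong (b *ℚ_) (sym (concat-combine (normal ∘ σ) m z)))
    where
      0<b : 0ℚ < b
      0<b = offset-positive {a = a} valid Gx₀ a·x₀<b
      normal-at : ∀ m → ∃ λ s → ∀ z → a (combine m z) ≡ b *ℚ normal s z
      normal-at = block-normal {a = a} valid 0<b on-facet independent
      σ : Fin k → Fin 6
      σ m = proj₁ (normal-at m)

  freeSumOfHexagons-facets : HasNumFacets G (6 ^ k)
  freeSumOfHexagons-facets = facet , facet-isFacet , facet-distinct , facet-complete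
    where
      facet : Fin (6 ^ k) → Vecℚ (k * 2) × ℚ
      facet j = facetNormal (finToFun j) , 1ℚ
      facet-isFacet : ∀ j → IsFacetIneq G (facetNormal (finToFun j)) 1ℚ
      facet-isFacet j = facetNormal-isFacet (finToFun j)
      facet-distinct : ∀ i j → i ≢ j → ¬ SameFace G (facet i) (facet j)
      facet-distinct i j i≢j =
        let m , differ = ¬∀⟶∃¬ k (λ m → finToFun i m ≡ finToFun j m) (λ m → finToFun i m F.≟ finToFun j m)
                                (i≢j ∘ finToFun-injective)
        in  facetNormal-distinct (finToFun i) (finToFun j) m differ
      facet-complete : ∀ a b → IsFacetIneq G a b → ∃ λ j → SameFace G (a , b) (facet j)
      facet-complete a b isFacet =
        let σ , 0<b , a≗bσ = facet-classification {a} isFacet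
        in  funToFin σ , sameFace-scaled 0<b λ i →
              trans (a≗bσ i) (cong (b *ℚ_) (facetNormal-cong (λ m → sym (finToFun-funToFin σ m)) i))

Γ-signed : ∀ {d} {P Q : FinPoset d} s {A} → IsAntichain P A → IsAntichain Q A → ΓGen P Q (signed s (ρ A))
Γ-signed true  {A} antiP _     = inj₁ (A , antiP , refl)
Γ-signed false {A} _     antiQ = inj₂ (A , antiQ , refl)

signed-zero : ∀ s {x : Vecℚ n} → (∀ i → x i ≡ 0ℚ) → ∀ i → signed s x i ≡ 0ℚ
signed-zero true  x≗0 i = x≗0 i
signed-zero false x≗0 i = cong -_ (x≗0 i)

signed-ρ-classify : ∀ s {A : Subset (k * 2)} →
  (∀ i → ρ A i ≡ 0ℚ) ⊎ ∃₂ (λ (m : Fin k) S → Nonempty S × AtBlock (ρ A) m (ρ S)) →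
  (∀ i → signed s (ρ A) i ≡ 0ℚ) ⊎ ∃₂ λ (m : Fin k) v → AtBlock (signed s (ρ A)) m (vertex v)
signed-ρ-classify s (inj₁ ρA≗0) = inj₁ (signed-zero s ρA≗0)
signed-ρ-classify s {A} (inj₂ (m , S , nonempty , at)) with vertex-of s S nonempty
... | v , refl , refl = inj₂ (m , v , AtBlock-signed s at)

Γ-freeSumOfHexagons : (P Q : FinPoset (k * 2)) →
  OrderIso P (I₂ⁿ-carrier k) (I₂ⁿ-rel k) → OrderIso Q (I₂ⁿ-carrier k) (I₂ⁿ-rel k) →
  (∀ (m : Fin k) → InducedI₂ P (combine m 0F) (combine m 1F)) →
  (∀ (m : Fin k) → InducedI₂ Q (combine m 0F) (combine m 1F)) →
  FreeSumOfHexagons (ΓGen P Q)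
Γ-freeSumOfHexagons P Q isoP isoQ blocksP blocksQ = record
  { origin   = ρ Sub.⊥ , inj₁ (Sub.⊥ , ⊥-antichain P blocksP , refl) , ρ-⊥
  ; vertexAt = λ m v → signed (isPositive v) (ρ (blockSubset m (vertexSet v))) ,
                       Γ-signed {P = P} {Q} (isPositive v) {blockSubset m (vertexSet v)} (blockSubset-antichain P blocksP m (vertexSet v)) (blockSubset-antichain Q blocksQ m (vertexSet v)) ,
                       AtBlock-signed (isPositive v) (ρ-blockSubset m (vertexSet v))
  ; classify = λ where
      x (inj₁ (A , antichain , refl)) → signed-ρ-classify true  {A} (antichain-ρ P blocksP isoP antichain)
      x (inj₂ (B , antichain , refl)) → signed-ρ-classify false {B} (antichain-ρ Q blocksQ isoQ antichain)
  }

corollary2p7 : (k : ℕ) (P Q : FinPoset (k * 2)) →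
    OrderIso P (I₂ⁿ-carrier k) (I₂ⁿ-rel k) →
    OrderIso Q (I₂ⁿ-carrier k) (I₂ⁿ-rel k) →
    (∀ (i : Fin k) → InducedI₂ P (combine i F.zero) (combine i (F.suc F.zero))) →
    (∀ (i : Fin k) → InducedI₂ Q (combine i F.zero) (combine i (F.suc F.zero))) →
    HasNumFacets (ΓGen P Q) (6 ^ k)
corollary2p7 k P Q isoP isoQ blocksP blocksQ =
  freeSumOfHexagons-facets (Γ-freeSumOfHexagons P Q isoP isoQ blocksP blocksQ)
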